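{- Let $n>1$ be an integer and $d>1$ a proper divisor of $n$. For every prime $p$ that divides $n$ but does not divide $d$, we have $\omega(X_n(1,d)) \leqslant p$. In particular, if the set $Q$ of primes dividing $n$ but not $d$ is nonempty, then $\omega(X_n(1,d)) \leqslant \min_{p\in Q} p$.
   Context: For an integer $n>1$ and a set $D$ of positive proper divisors of $n$, the gcd-graph $X_n(D)$ has vertex set $\mathbb{Z}_n=\{0,1,\ldots,n-1\}$, and two distinct vertices $a,b$ are adjacent if and only if $\gcd(a-b,n)\in D$; $X_n(1,d)$ denotes $X_n(\{1,d\})$. $\omega$ denotes the clique number. -}

module Defs where

open import Data.Nat.Base using (ℕ; ∣_-_∣; _≤_)
open import Data.Nat.GCD using (gcd)
open import Data.Fin using (Fin; toℕ)
open import Data.List using (List; length)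
open import Data.List.Relation.Unary.AllPairs using (AllPairs)
open import Data.Sum using (_⊎_)
open import Data.Product using (_×_)
open import Relation.Binary.PropositionalEquality using (_≡_)
open import Relation.Nullary using (¬_)

-- Vertices of X_n(D) are elements of Z_n, represented by Fin n.
-- gcd(a - b, n) for a, b ∈ Z_n equals gcd(|a - b|, n) with a, b taken in {0,…,n-1}.
gcdDiff : (n : ℕ) → Fin n → Fin n → ℕ
gcdDiff n a b = gcd ∣ toℕ a - toℕ b ∣ n

Adj : (n d : ℕ) → Fin n → Fin n → Set
Adj n d a b = ¬ (a ≡ b) × (gcdDiff n a b ≡ 1 ⊎ gcdDiff n a b ≡ d)

IsClique : (n d : ℕ) → List (Fin n) → Set
IsClique n d vs = AllPairs (Adj n d) vs

CliqueNumberAtMost : (n d k : ℕ) → Set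
CliqueNumberAtMost n d k = (vs : List (Fin n)) → IsClique n d vs → length vs ≤ k

-- Two vertices of X_n(1,d) that are congruent modulo a prime p ∣ n, p ∤ d, cannot be adjacent:
-- p would divide gcd(a − b, n), which is 1 or d. So reduction modulo p is injective on a clique,
-- and a clique has at most p vertices by the pigeonhole principle.
module Submission where

open import Defs
open import Data.Nat.Base using (ℕ; _<_; _≤_; _+_; _*_; _%_; _/_; ∣_-_∣; NonZero; s<s)
open import Data.Nat.Divisibility using (_∣_; divides; ∣1⇒≡1)
open import Data.Nat.DivMod using (m≡m%n+[m/n]*n; m%n<n)
open import Data.Nat.GCD using (gcd-greatest)
open import Data.Nat.Primality using (Prime; prime⇒nonZero; ¬prime[1])
open import Data.Nat.Properties using (≮⇒≥; *-distribʳ-∣-∣; ∣m+n-m+o∣≡∣n-o∣)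
open import Data.Fin as Fin using (Fin; toℕ; fromℕ<; zero; suc)
open import Data.Fin.Properties using (pigeonhole; toℕ-fromℕ<)
open import Data.List using (List; length; lookup)
open import Data.List.Membership.Propositional.Properties using (∈-lookup)
open import Data.List.Relation.Unary.All as All using ()
open import Data.List.Relation.Unary.AllPairs using (AllPairs; _∷_)
open import Data.Product using (_×_; _,_)
open import Data.Sum using (_⊎_; inj₁; inj₂)
open import Function using (_∘_)
open import Relation.Nullary using (¬_)
open import Relation.Binary.PropositionalEquality
  using (_≡_; _≢_; sym; trans; cong; cong₂; subst; module ≡-Reasoning)

lookup-AllPairs : ∀ {A : Set} {R : A → A → Set} {xs : List A} → AllPairs R xs →
                  ∀ {i j : Fin (length xs)} → i Fin.< j → R (lookup xs i) (lookup xs j)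
lookup-AllPairs (rx ∷ _)  {zero}  {suc j} _         = All.lookup rx (∈-lookup j)
lookup-AllPairs (_ ∷ rxs) {suc i} {suc j} (s<s i<j) = lookup-AllPairs rxs i<j

length-AllPairs-≤ : ∀ {A : Set} {R : A → A → Set} {k : ℕ} (f : A → Fin k) →
                    (∀ {x y} → R x y → f x ≢ f y) →
                    ∀ {xs : List A} → AllPairs R xs → length xs ≤ k
length-AllPairs-≤ f separates {xs} rxs = ≮⇒≥ λ k<length →
  let i , j , i<j , fᵢ≡fⱼ = pigeonhole k<length (f ∘ lookup xs)
  in separates (lookup-AllPairs rxs i<j) fᵢ≡fⱼ

m%n≡o%n⇒n∣∣m-o∣ : ∀ m o n .{{_ : NonZero n}} → m % n ≡ o % n → n ∣ ∣ m - o ∣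
m%n≡o%n⇒n∣∣m-o∣ m o n eq = divides ∣ m / n - o / n ∣ (begin
  ∣ m - o ∣
    ≡⟨ cong₂ ∣_-_∣ (m≡m%n+[m/n]*n m n) (trans (m≡m%n+[m/n]*n o n) (cong (_+ o / n * n) (sym eq))) ⟩
  ∣ m % n + m / n * n - m % n + o / n * n ∣
    ≡⟨ ∣m+n-m+o∣≡∣n-o∣ (m % n) _ _ ⟩
  ∣ m / n * n - o / n * n ∣
    ≡⟨ *-distribʳ-∣-∣ n (m / n) (o / n) ⟨
  ∣ m / n - o / n ∣ * n ∎)
  where open ≡-Reasoning

residue : ∀ {n} (p : ℕ) .{{_ : NonZero p}} → Fin n → Fin p
residue p a = fromℕ< (m%n<n (toℕ a) p)

residue-≡⇒%-≡ : ∀ {n} p .{{_ : NonZero p}} {a b : Fin n} →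
                residue p a ≡ residue p b → toℕ a % p ≡ toℕ b % p
residue-≡⇒%-≡ p {a} {b} eq =
  trans (sym (toℕ-fromℕ< (m%n<n (toℕ a) p))) (trans (cong toℕ eq) (toℕ-fromℕ< (m%n<n (toℕ b) p)))

module _ {n d p : ℕ} (prime : Prime p) (p∣n : p ∣ n) (p∤d : ¬ p ∣ d) where

  private instance
    p≢0 : NonZero p
    p≢0 = prime⇒nonZero prime

  Adj⇒residue-≢ : ∀ {a b : Fin n} → Adj n d a b → residue p a ≢ residue p b
  Adj⇒residue-≢ {a} {b} (_ , gcd≡1∨d) same = excluded gcd≡1∨d
    where
    p∣gcd : p ∣ gcdDiff n a b
    p∣gcd = gcd-greatest (m%n≡o%n⇒n∣∣m-o∣ (toℕ a) (toℕ b) p (residue-≡⇒%-≡ p same)) p∣n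

    excluded : ¬ (gcdDiff n a b ≡ 1 ⊎ gcdDiff n a b ≡ d)
    excluded (inj₁ ≡1) = ¬prime[1] (subst Prime (∣1⇒≡1 (subst (p ∣_) ≡1 p∣gcd)) prime)
    excluded (inj₂ ≡d) = p∤d (subst (p ∣_) ≡d p∣gcd)

  cliqueNumber≤prime : CliqueNumberAtMost n d p
  cliqueNumber≤prime _ = length-AllPairs-≤ (residue p) Adj⇒residue-≢

lemma3p3 : (n d : ℕ) → 1 < n → 1 < d → d < n → d ∣ n →
    ((p : ℕ) → Prime p → p ∣ n → ¬ (p ∣ d) → CliqueNumberAtMost n d p)
    × ((m : ℕ) → Prime m → m ∣ n → ¬ (m ∣ d) →
       ((q : ℕ) → Prime q → q ∣ n → ¬ (q ∣ d) → m ≤ q) →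
       CliqueNumberAtMost n d m)
lemma3p3 n d _ _ _ _ =
    (λ p prime p∣n p∤d → cliqueNumber≤prime prime p∣n p∤d)
  , (λ m prime m∣n m∤d _ → cliqueNumber≤prime prime m∣n m∤d)
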